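{- Let $A,U\subseteq[n]$. If $|A|\cdot|U|\geq 6n$, then $$e(H^U(A))>\frac{|A|^2|U|^2}{12n}.$$
   Context: $[n]=\{1,\dots,n\}$. A Sidon 4-tuple is an (ordered) 4-tuple $(a,b,c,d)$ of integers with $a+b=c+d$ and $\{a,b\}\cap\{c,d\}=\emptyset$. For $A,U\subseteq[n]$, $H^U(A)$ is the multigraph on vertex set $A$ in which, for every $a_1,a_2\in A$ with $a_1<a_2$, the multiplicity of the edge $a_1a_2$ equals the number of ordered pairs $(u_1,u_2)$ with $u_1,u_2\in U$ such that $(a_1,u_1,u_2,a_2)$ is a Sidon 4-tuple. $e(H^U(A))$ denotes the number of edges of $H^U(A)$ counted with multiplicity. -}

module Defs where

open import Data.Nat using (ℕ; suc; _+_; _<_)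
open import Data.Nat.Properties using (_≟_; _<?_)
open import Data.Fin using (Fin; toℕ)
open import Data.Fin.Subset using (Subset; _∈_)
open import Data.Fin.Subset.Properties using (_∈?_)
open import Data.List using (List; length; filter; cartesianProduct)
open import Data.List.Base using (allFin)
open import Data.Product using (_×_; _,_)
open import Relation.Nullary using (Dec; ¬_; _×-dec_; ¬?)
open import Relation.Binary.PropositionalEquality using (_≡_)

-- A subset of [n] = {1,…,n} is represented as a Subset n of Fin n;
-- the element i : Fin n stands for the integer toℕ i + 1.
val : {n : ℕ} → Fin n → ℕ
val i = suc (toℕ i)

elems : {n : ℕ} → Subset n → List (Fin n)
elems {n} S = filter (λ i → i ∈? S) (allFin n)

SidonQuad : ℕ → ℕ → ℕ → ℕ → Set
SidonQuad a b c d =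
  (a + b ≡ c + d) × (¬ a ≡ c) × (¬ a ≡ d) × (¬ b ≡ c) × (¬ b ≡ d)

sidonQuad? : (a b c d : ℕ) → Dec (SidonQuad a b c d)
sidonQuad? a b c d =
  (a + b ≟ c + d) ×-dec ¬? (a ≟ c) ×-dec ¬? (a ≟ d) ×-dec ¬? (b ≟ c) ×-dec ¬? (b ≟ d)

-- A tuple (a₁ , a₂ , u₁ , u₂) contributing one unit of multiplicity to the edge a₁a₂
-- of H^U(A): a₁ < a₂ and (a₁ , u₁ , u₂ , a₂) is a Sidon 4-tuple.
EdgeWitness : {n : ℕ} → (Fin n × Fin n) × (Fin n × Fin n) → Set
EdgeWitness ((a₁ , a₂) , (u₁ , u₂)) =
  (val a₁ < val a₂) × SidonQuad (val a₁) (val u₁) (val u₂) (val a₂)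

edgeWitness? : {n : ℕ} → (t : (Fin n × Fin n) × (Fin n × Fin n)) → Dec (EdgeWitness t)
edgeWitness? ((a₁ , a₂) , (u₁ , u₂)) =
  (val a₁ <? val a₂) ×-dec sidonQuad? (val a₁) (val u₁) (val u₂) (val a₂)

eH : {n : ℕ} → (U A : Subset n) → ℕ
eH U A =
  length (filter edgeWitness?
    (cartesianProduct (cartesianProduct (elems A) (elems A))
                      (cartesianProduct (elems U) (elems U))))

-- Write x = |A||U| and let r(s) be the number of pairs (a , u) ∈ A × U with a + u = s.
-- The sums take only 2n − 1 values and r has total mass x, so Cauchy–Schwarz gives
-- x² ≤ (2n − 1) E for the additive energy E = Σ r(s)², the number of pairs of pairs
-- with a₁ + u₁ = a₂ + u₂. Such a coincidence is trivial ((a₂ , u₂) = (a₁ , u₁) or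
-- (u₁ , a₁), at most 2x cases) or a Sidon 4-tuple contributing to e = e(H^U(A)) in one
-- of its two orientations; hence E ≤ 2e + 2x, and x ≥ 6n turns the two bounds into
-- x² < 12 n e.
module Submission where

open import Defs
open import Data.Nat using (ℕ; zero; suc; _+_; _*_; _∸_; _^_; _≤_; _<_; z≤n; s≤s)
open import Data.Nat.Properties
open import Data.Nat.Tactic.RingSolver using (solve-∀)
open import Data.Fin using (Fin; toℕ) renaming (zero to fzero; suc to fsuc)
open import Data.Fin.Properties using (toℕ-injective; toℕ≤pred[n]) renaming (_≟_ to _≟ᶠ_)
open import Data.Fin.Subset using (Subset; Side; inside; outside; ∣_∣)
open import Data.Fin.Subset.Properties using (_∈?_)
open import Data.List
  using (List; []; _∷_; _++_; length; filter; map; cartesianProduct; tabulate; downFrom)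
open import Data.List.Properties using (length-++; length-map; length-downFrom)
open import Data.List.Membership.Propositional using (_∈_)
open import Data.List.Membership.Propositional.Properties using (∈-downFrom⁺)
open import Data.List.Relation.Unary.All as All using (All; []; _∷_)
open import Data.List.Relation.Unary.Any using (here; there)
open import Data.List.Relation.Unary.AllPairs using ([]; _∷_)
open import Data.List.Relation.Unary.Unique.Propositional using (Unique)
open import Data.List.Relation.Unary.Unique.Propositional.Properties
  using (filter⁺; allFin⁺; downFrom⁺; cartesianProduct⁺)
open import Data.Vec using ([]; _∷_)
open import Data.Product using (_×_; _,_; _,′_; swap)
open import Data.Product.Properties using (≡-dec)
open import Data.Sum using (_⊎_; inj₁; inj₂; [_,_]′)
open import Function using (_∘_; id)
open import Relation.Nullary using (Dec; yes; no; contradiction)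
open import Relation.Unary using (Decidable)
open import Relation.Binary using (DecidableEquality; tri<; tri≈; tri>)
open import Relation.Binary.PropositionalEquality
open import Algebra.Properties.CommutativeSemigroup +-commutativeSemigroup
  using () renaming (interchange to +-interchange)

𝟙 : ∀ {p} {P : Set p} → Dec P → ℕ
𝟙 (yes _) = 1
𝟙 (no _)  = 0

1≤𝟙 : ∀ {p} {P : Set p} → P → (P? : Dec P) → 1 ≤ 𝟙 P?
1≤𝟙 _ (yes _) = ≤-refl
1≤𝟙 p (no ¬p) = contradiction p ¬p

𝟙-cover : ∀ {p q r s t} {P : Set p} {Q : Set q} {R : Set r} {S : Set s} {T : Set t} →
          (P → (Q ⊎ R) ⊎ (S ⊎ T)) →
          (P? : Dec P) (Q? : Dec Q) (R? : Dec R) (S? : Dec S) (T? : Dec T) →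
          𝟙 P? ≤ (𝟙 Q? + 𝟙 R?) + (𝟙 S? + 𝟙 T?)
𝟙-cover cover (no _)  Q? R? S? T? = z≤n
𝟙-cover cover (yes p) Q? R? S? T? with cover p
... | inj₁ (inj₁ q) = ≤-trans (1≤𝟙 q Q?) (≤-trans (m≤m+n _ (𝟙 R?)) (m≤m+n _ (𝟙 S? + 𝟙 T?)))
... | inj₁ (inj₂ r) = ≤-trans (1≤𝟙 r R?) (≤-trans (m≤n+m _ (𝟙 Q?)) (m≤m+n _ (𝟙 S? + 𝟙 T?)))
... | inj₂ (inj₁ s) = ≤-trans (1≤𝟙 s S?) (≤-trans (m≤m+n _ (𝟙 T?)) (m≤n+m _ (𝟙 Q? + 𝟙 R?)))
... | inj₂ (inj₂ t) = ≤-trans (1≤𝟙 t T?) (≤-trans (m≤n+m _ (𝟙 S?)) (m≤n+m _ (𝟙 Q? + 𝟙 R?)))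

module _ {a} {X : Set a} where

  ∑ : List X → (X → ℕ) → ℕ
  ∑ []       f = 0
  ∑ (x ∷ xs) f = f x + ∑ xs f

  infix 8 ∑
  syntax ∑ xs (λ x → e) = ∑[ x ∈ xs ] e

  ∑-cong : ∀ xs {f g : X → ℕ} → (∀ x → f x ≡ g x) → ∑ xs f ≡ ∑ xs g
  ∑-cong []       f≡g = refl
  ∑-cong (x ∷ xs) f≡g = cong₂ _+_ (f≡g x) (∑-cong xs f≡g)

  ∑-mono : ∀ xs {f g : X → ℕ} → (∀ x → f x ≤ g x) → ∑ xs f ≤ ∑ xs g
  ∑-mono []       f≤g = z≤n
  ∑-mono (x ∷ xs) f≤g = +-mono-≤ (f≤g x) (∑-mono xs f≤g)

  ∑-+ : ∀ xs (f g : X → ℕ) → ∑[ x ∈ xs ] (f x + g x) ≡ ∑ xs f + ∑ xs g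
  ∑-+ []       f g = refl
  ∑-+ (x ∷ xs) f g = begin
    (f x + g x) + ∑[ x ∈ xs ] (f x + g x) ≡⟨ cong ((f x + g x) +_) (∑-+ xs f g) ⟩
    (f x + g x) + (∑ xs f + ∑ xs g)       ≡⟨ +-interchange (f x) (g x) _ _ ⟩
    (f x + ∑ xs f) + (g x + ∑ xs g)       ∎
    where open ≡-Reasoning

  ∑-*ˡ : ∀ xs c (f : X → ℕ) → ∑[ x ∈ xs ] (c * f x) ≡ c * ∑ xs f
  ∑-*ˡ []       c f = sym (*-zeroʳ c)
  ∑-*ˡ (x ∷ xs) c f = trans (cong (c * f x +_) (∑-*ˡ xs c f)) (sym (*-distribˡ-+ c (f x) _))

  ∑-*ʳ : ∀ xs c (f : X → ℕ) → ∑[ x ∈ xs ] (f x * c) ≡ ∑ xs f * c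
  ∑-*ʳ []       c f = refl
  ∑-*ʳ (x ∷ xs) c f = trans (cong (f x * c +_) (∑-*ʳ xs c f)) (sym (*-distribʳ-+ c (f x) _))

  ∑-const : ∀ xs c → ∑[ x ∈ xs ] c ≡ length xs * c
  ∑-const []       c = refl
  ∑-const (x ∷ xs) c = cong (c +_) (∑-const xs c)

  length-filter : ∀ {p} {P : X → Set p} (P? : Decidable P) xs →
                  length (filter P? xs) ≡ ∑[ x ∈ xs ] 𝟙 (P? x)
  length-filter P? []       = refl
  length-filter P? (x ∷ xs) with P? x
  ... | yes _ = cong suc (length-filter P? xs)
  ... | no _  = length-filter P? xs

module _ {a b} {X : Set a} {Y : Set b} where

  ∑-comm : ∀ xs ys (f : X → Y → ℕ) → ∑[ x ∈ xs ] ∑[ y ∈ ys ] f x y ≡ ∑[ y ∈ ys ] ∑[ x ∈ xs ] f x y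
  ∑-comm []       ys f = sym (trans (∑-const ys 0) (*-zeroʳ (length ys)))
  ∑-comm (x ∷ xs) ys f = trans (cong (∑ ys (f x) +_) (∑-comm xs ys f)) (sym (∑-+ ys (f x) _))

  ∑-*-∑ : ∀ xs ys (f : X → ℕ) (g : Y → ℕ) → ∑ xs f * ∑ ys g ≡ ∑[ x ∈ xs ] ∑[ y ∈ ys ] (f x * g y)
  ∑-*-∑ xs ys f g = trans (sym (∑-*ʳ xs (∑ ys g) f)) (∑-cong xs λ x → sym (∑-*ˡ ys (f x) g))

  ∑²-+ : ∀ xs ys (f g : X → Y → ℕ) →
         ∑[ x ∈ xs ] ∑[ y ∈ ys ] (f x y + g x y) ≡ ∑[ x ∈ xs ] ∑ ys (f x) + ∑[ x ∈ xs ] ∑ ys (g x)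
  ∑²-+ xs ys f g = trans (∑-cong xs λ x → ∑-+ ys (f x) (g x)) (∑-+ xs _ _)

  ∑-cartesianProduct : ∀ xs ys (f : X × Y → ℕ) →
                       ∑ (cartesianProduct xs ys) f ≡ ∑[ x ∈ xs ] ∑[ y ∈ ys ] f (x , y)
  ∑-cartesianProduct []       ys f = refl
  ∑-cartesianProduct (x ∷ xs) ys f =
    trans (∑-++ (map (x ,′_) ys)) (cong₂ _+_ (∑-map ys) (∑-cartesianProduct xs ys f))
    where
    ∑-++ : ∀ us {vs} → ∑ (us ++ vs) f ≡ ∑ us f + ∑ vs f
    ∑-++ []       = refl
    ∑-++ (u ∷ us) = trans (cong (f u +_) (∑-++ us)) (sym (+-assoc (f u) _ _))
    ∑-map : ∀ zs → ∑ (map (x ,′_) zs) f ≡ ∑[ y ∈ zs ] f (x , y)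
    ∑-map []       = refl
    ∑-map (z ∷ zs) = cong (f (x , z) +_) (∑-map zs)

  length-cartesianProduct : ∀ (xs : List X) (ys : List Y) →
                            length (cartesianProduct xs ys) ≡ length xs * length ys
  length-cartesianProduct []       ys = refl
  length-cartesianProduct (x ∷ xs) ys =
    trans (length-++ (map (x ,′_) ys))
          (cong₂ _+_ (length-map (x ,′_) ys) (length-cartesianProduct xs ys))

2mn≤m²+n² : ∀ m n → 2 * (m * n) ≤ m * m + n * n
2mn≤m²+n² m n = [ ordered , reversed ]′ (≤-total n m)
  where
  ordered : ∀ {m n} → n ≤ m → 2 * (m * n) ≤ m * m + n * n
  ordered {m} {n} n≤m = subst (λ k → 2 * (k * n) ≤ k * k + n * n) (m+[n∸m]≡n n≤m)
    (≤-trans (m≤m+n _ (d * d)) (≤-reflexive (square-expansion n d)))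
    where
    d = m ∸ n
    square-expansion : ∀ n d → 2 * ((n + d) * n) + d * d ≡ (n + d) * (n + d) + n * n
    square-expansion = solve-∀
  reversed : m ≤ n → 2 * (m * n) ≤ m * m + n * n
  reversed m≤n = subst₂ _≤_ (cong (2 *_) (*-comm n m)) (+-comm (n * n) (m * m)) (ordered m≤n)

cauchy-schwarz : ∀ {a} {X : Set a} (xs : List X) (f : X → ℕ) →
                 ∑ xs f * ∑ xs f ≤ length xs * ∑[ x ∈ xs ] (f x * f x)
cauchy-schwarz xs f = *-cancelˡ-≤ 2 (begin
  2 * (∑ xs f * ∑ xs f)
    ≡⟨ cong (2 *_) (∑-*-∑ xs xs f f) ⟩
  2 * (∑[ x ∈ xs ] ∑[ y ∈ xs ] (f x * f y))
    ≡⟨ sym (trans (∑-cong xs λ x → ∑-*ˡ xs 2 _) (∑-*ˡ xs 2 _)) ⟩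
  ∑[ x ∈ xs ] ∑[ y ∈ xs ] (2 * (f x * f y))
    ≤⟨ ∑-mono xs (λ x → ∑-mono xs λ y → 2mn≤m²+n² (f x) (f y)) ⟩
  ∑[ x ∈ xs ] ∑[ y ∈ xs ] (f x * f x + f y * f y)
    ≡⟨ ∑²-+ xs xs _ _ ⟩
  ∑[ x ∈ xs ] ∑[ y ∈ xs ] (f x * f x) + ∑[ x ∈ xs ] Q
    ≡⟨ cong₂ _+_ (trans (∑-cong xs λ x → ∑-const xs _) (∑-*ˡ xs (length xs) _)) (∑-const xs Q) ⟩
  length xs * Q + length xs * Q
    ≡⟨ cong (length xs * Q +_) (sym (+-identityʳ _)) ⟩
  2 * (length xs * Q) ∎)
  where
  open ≤-Reasoning
  Q = ∑[ x ∈ xs ] (f x * f x)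

module _ {a} {X : Set a} (_≟_ : DecidableEquality X) where

  ∑-sift-∉ : ∀ {x ys} (g : X → ℕ) → All (x ≢_) ys → ∑[ y ∈ ys ] (𝟙 (y ≟ x) * g y) ≡ 0
  ∑-sift-∉ g [] = refl
  ∑-sift-∉ {x} {y ∷ ys} g (x≢y ∷ x∉ys) with y ≟ x
  ... | yes y≡x = contradiction (sym y≡x) x≢y
  ... | no _    = ∑-sift-∉ g x∉ys

  ∑-sift : ∀ {x ys} (g : X → ℕ) → Unique ys → x ∈ ys → ∑[ y ∈ ys ] (𝟙 (y ≟ x) * g y) ≡ g x
  ∑-sift {x} {x ∷ ys} g (x∉ys ∷ _) (here refl) with x ≟ x
  ... | yes _   = trans (cong₂ _+_ (+-identityʳ (g x)) (∑-sift-∉ g x∉ys)) (+-identityʳ (g x))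
  ... | no x≢x  = contradiction refl x≢x
  ∑-sift {x} {y ∷ ys} g (y∉ys ∷ uniq) (there x∈ys) with y ≟ x
  ... | yes refl = contradiction refl (All.lookup y∉ys x∈ys)
  ... | no _     = ∑-sift g uniq x∈ys

  ∑-𝟙≟≤1 : ∀ {x ys} → Unique ys → ∑[ y ∈ ys ] 𝟙 (y ≟ x) ≤ 1
  ∑-𝟙≟≤1 [] = z≤n
  ∑-𝟙≟≤1 {x} {y ∷ ys} (y∉ys ∷ uniq) with y ≟ x
  ... | yes refl = ≤-reflexive (cong suc
        (trans (∑-cong ys λ z → sym (*-identityʳ _)) (∑-sift-∉ (λ _ → 1) y∉ys)))
  ... | no _     = ∑-𝟙≟≤1 uniq

  ∑∑-𝟙≟≤length : ∀ {ys} → Unique ys → (g : X → X) →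
                 ∑[ x ∈ ys ] ∑[ y ∈ ys ] 𝟙 (y ≟ g x) ≤ length ys
  ∑∑-𝟙≟≤length {ys} uniq g = begin
    ∑[ x ∈ ys ] ∑[ y ∈ ys ] 𝟙 (y ≟ g x) ≤⟨ ∑-mono ys (λ x → ∑-𝟙≟≤1 uniq) ⟩
    ∑[ x ∈ ys ] 1                       ≡⟨ ∑-const ys 1 ⟩
    length ys * 1                       ≡⟨ *-identityʳ _ ⟩
    length ys                           ∎
    where open ≤-Reasoning

module _ {a} {X : Set a} (f : X → ℕ) where

  energy : List X → ℕ
  energy P = ∑[ p ∈ P ] ∑[ q ∈ P ] 𝟙 (f p ≟ f q)

  representations : List X → ℕ → ℕ
  representations P s = ∑[ p ∈ P ] 𝟙 (s ≟ f p)

  module _ {N} (f<N : ∀ p → f p < N) (P : List X) where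

    private
      r = representations P
      S = downFrom N

    ∑-representations : ∑ S r ≡ length P
    ∑-representations = begin
      ∑[ s ∈ S ] ∑[ p ∈ P ] 𝟙 (s ≟ f p)
        ≡⟨ ∑-comm S P _ ⟩
      ∑[ p ∈ P ] ∑[ s ∈ S ] 𝟙 (s ≟ f p)
        ≡⟨ ∑-cong P (λ p → ∑-cong S λ s → sym (*-identityʳ _)) ⟩
      ∑[ p ∈ P ] ∑[ s ∈ S ] (𝟙 (s ≟ f p) * 1)
        ≡⟨ ∑-cong P (λ p → ∑-sift _≟_ _ (downFrom⁺ N) (∈-downFrom⁺ (f<N p))) ⟩
      ∑[ p ∈ P ] 1
        ≡⟨ ∑-const P 1 ⟩
      length P * 1
        ≡⟨ *-identityʳ _ ⟩
      length P ∎
      where open ≡-Reasoning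

    ∑-representations² : ∑[ s ∈ S ] (r s * r s) ≡ energy P
    ∑-representations² = begin
      ∑[ s ∈ S ] (r s * r s)
        ≡⟨ ∑-cong S (λ s → ∑-*-∑ P P _ _) ⟩
      ∑[ s ∈ S ] ∑[ p ∈ P ] ∑[ q ∈ P ] (𝟙 (s ≟ f p) * 𝟙 (s ≟ f q))
        ≡⟨ trans (∑-comm S P _) (∑-cong P λ p → ∑-comm S P _) ⟩
      ∑[ p ∈ P ] ∑[ q ∈ P ] ∑[ s ∈ S ] (𝟙 (s ≟ f p) * 𝟙 (s ≟ f q))
        ≡⟨ ∑-cong P (λ p → ∑-cong P λ q → ∑-sift _≟_ _ (downFrom⁺ N) (∈-downFrom⁺ (f<N p))) ⟩
      energy P ∎
      where open ≡-Reasoning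

    length²≤N*energy : length P * length P ≤ N * energy P
    length²≤N*energy = begin
      length P * length P
        ≡⟨ sym (cong₂ _*_ ∑-representations ∑-representations) ⟩
      ∑ S r * ∑ S r
        ≤⟨ cauchy-schwarz S r ⟩
      length S * ∑[ s ∈ S ] (r s * r s)
        ≡⟨ cong₂ _*_ (length-downFrom N) ∑-representations² ⟩
      N * energy P ∎
      where open ≤-Reasoning

sidonQuad : ∀ {a b c d} → a + b ≡ d + c → a ≢ d → b ≢ d → SidonQuad a b c d
sidonQuad {a} {b} {c} {d} eq a≢d b≢d = trans eq (+-comm d c) , a≢c , a≢d , b≢c , b≢d
  where
  a≢c : a ≢ c
  a≢c a≡c = b≢d (+-cancelˡ-≡ a b d (trans eq (trans (cong (d +_) (sym a≡c)) (+-comm d a))))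
  b≢c : b ≢ c
  b≢c b≡c = a≢d (+-cancelʳ-≡ b a d (trans eq (cong (d +_) (sym b≡c))))

sidonQuad-reverse : ∀ {a b c d} → SidonQuad a b c d → SidonQuad d c b a
sidonQuad-reverse {a} {b} {c} {d} (eq , a≢c , a≢d , b≢c , b≢d) =
  trans (+-comm d c) (trans (sym eq) (+-comm a b)) ,
  b≢d ∘ sym , a≢d ∘ sym , b≢c ∘ sym , a≢c ∘ sym

sum-collision : ∀ {a b c d} → a + b ≡ d + c →
                ((a < d × SidonQuad a b c d) ⊎ (d < a × SidonQuad d c b a)) ⊎
                ((d ≡ a × c ≡ b) ⊎ (d ≡ b × c ≡ a))
sum-collision {a} {b} {c} {d} eq with d ≟ b | a ≟ d
... | yes refl | _        = inj₂ (inj₂ (refl , +-cancelˡ-≡ d c a (trans (sym eq) (+-comm a d))))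
... | no _     | yes refl = inj₂ (inj₁ (refl , sym (+-cancelˡ-≡ a b c eq)))
... | no d≢b   | no a≢d   with <-cmp a d
...   | tri< a<d _ _ = inj₁ (inj₁ (a<d , sidonQuad eq a≢d (d≢b ∘ sym)))
...   | tri≈ _ a≡d _ = contradiction a≡d a≢d
...   | tri> _ _ d<a = inj₁ (inj₂ (d<a , sidonQuad-reverse (sidonQuad eq a≢d (d≢b ∘ sym))))

module _ {n : ℕ} where

  -- toℕ rather than val: the sums then lie below 2n − 1 instead of 2n + 1, which the
  -- constant 12 needs.
  pairSum : Fin n × Fin n → ℕ
  pairSum (a , u) = toℕ a + toℕ u

  Witness : (p q : Fin n × Fin n) → Set
  Witness (a₁ , u₁) (a₂ , u₂) = EdgeWitness ((a₁ , a₂) , (u₁ , u₂))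

  witness? : ∀ p q → Dec (Witness p q)
  witness? (a₁ , u₁) (a₂ , u₂) = edgeWitness? ((a₁ , a₂) , (u₁ , u₂))

  edgeCount : List (Fin n × Fin n) → ℕ
  edgeCount P = ∑[ p ∈ P ] ∑[ q ∈ P ] 𝟙 (witness? p q)

  _≟ᵖ_ : DecidableEquality (Fin n × Fin n)
  _≟ᵖ_ = ≡-dec _≟ᶠ_ _≟ᶠ_

  val-injective : ∀ {i j : Fin n} → val i ≡ val j → i ≡ j
  val-injective = toℕ-injective ∘ suc-injective

  val+val : ∀ (i j : Fin n) → val i + val j ≡ 2 + (toℕ i + toℕ j)
  val+val i j = cong suc (+-suc (toℕ i) (toℕ j))

  pairSum-collision : ∀ p q → pairSum p ≡ pairSum q →
                      (Witness p q ⊎ Witness q p) ⊎ (q ≡ p ⊎ q ≡ swap p)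
  pairSum-collision (a₁ , u₁) (a₂ , u₂) eq
    with sum-collision (trans (val+val a₁ u₁) (trans (cong (2 +_) eq) (sym (val+val a₂ u₂))))
  ... | inj₁ witness            = inj₁ witness
  ... | inj₂ (inj₁ (a≡ , u≡)) = inj₂ (inj₁ (cong₂ _,_ (val-injective a≡) (val-injective u≡)))
  ... | inj₂ (inj₂ (a≡ , u≡)) = inj₂ (inj₂ (cong₂ _,_ (val-injective a≡) (val-injective u≡)))

  𝟙-pairSum-collision : ∀ p q → 𝟙 (pairSum p ≟ pairSum q) ≤
                        (𝟙 (witness? p q) + 𝟙 (witness? q p)) + (𝟙 (q ≟ᵖ p) + 𝟙 (q ≟ᵖ swap p))
  𝟙-pairSum-collision p q = 𝟙-cover (pairSum-collision p q)
    (pairSum p ≟ pairSum q) (witness? p q) (witness? q p) (q ≟ᵖ p) (q ≟ᵖ swap p)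

  energy≤2edges+2length : ∀ P → Unique P →
                          energy pairSum P ≤ (edgeCount P + edgeCount P) + (length P + length P)
  energy≤2edges+2length P uniq = begin
    energy pairSum P
      ≤⟨ ∑-mono P (λ p → ∑-mono P (𝟙-pairSum-collision p)) ⟩
    ∑[ p ∈ P ] ∑[ q ∈ P ] ((W p q + W q p) + (T p q + T′ p q))
      ≡⟨ trans (∑²-+ P P _ _) (cong₂ _+_ (∑²-+ P P _ _) (∑²-+ P P _ _)) ⟩
    (edgeCount P + ∑[ p ∈ P ] ∑[ q ∈ P ] W q p) +
    (∑[ p ∈ P ] ∑[ q ∈ P ] T p q + ∑[ p ∈ P ] ∑[ q ∈ P ] T′ p q)
      ≤⟨ +-mono-≤ (≤-reflexive (cong (edgeCount P +_) (∑-comm P P _)))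
                  (+-mono-≤ (∑∑-𝟙≟≤length _≟ᵖ_ uniq id) (∑∑-𝟙≟≤length _≟ᵖ_ uniq swap)) ⟩
    (edgeCount P + edgeCount P) + (length P + length P) ∎
    where
    open ≤-Reasoning
    W T T′ : Fin n × Fin n → Fin n × Fin n → ℕ
    W p q = 𝟙 (witness? p q)
    T p q = 𝟙 (q ≟ᵖ p)
    T′ p q = 𝟙 (q ≟ᵖ swap p)

length-filter-∈?-suc : ∀ {n k} (s : Side) (S : Subset n) (g : Fin k → Fin n) →
                       length (filter (_∈? (s ∷ S)) (tabulate (fsuc ∘ g))) ≡
                       length (filter (_∈? S) (tabulate g))
length-filter-∈?-suc {k = zero}  s S g = refl
length-filter-∈?-suc {k = suc k} s S g with g fzero ∈? S
... | yes _ = cong suc (length-filter-∈?-suc s S (g ∘ fsuc))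
... | no _  = length-filter-∈?-suc s S (g ∘ fsuc)

length-elems : ∀ {n} (S : Subset n) → length (elems S) ≡ ∣ S ∣
length-elems []            = refl
length-elems (inside ∷ S)  = cong suc (trans (length-filter-∈?-suc inside S id) (length-elems S))
length-elems (outside ∷ S) = trans (length-filter-∈?-suc outside S id) (length-elems S)

elems-unique : ∀ {n} (S : Subset n) → Unique (elems S)
elems-unique {n} S = filter⁺ (_∈? S) (allFin⁺ n)

eH≡edgeCount : ∀ {n} (U A : Subset n) → eH U A ≡ edgeCount (cartesianProduct (elems A) (elems U))
eH≡edgeCount U A = begin
  eH U A
    ≡⟨ length-filter edgeWitness? (cartesianProduct (cartesianProduct L L) (cartesianProduct M M)) ⟩
  ∑[ t ∈ cartesianProduct (cartesianProduct L L) (cartesianProduct M M) ] 𝟙 (edgeWitness? t)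
    ≡⟨ ∑-cartesianProduct (cartesianProduct L L) (cartesianProduct M M) _ ⟩
  ∑[ aa ∈ cartesianProduct L L ] ∑[ uu ∈ cartesianProduct M M ] 𝟙 (edgeWitness? (aa , uu))
    ≡⟨ trans (∑-cartesianProduct L L _) (∑-cong L λ a₁ → ∑-cong L λ a₂ → ∑-cartesianProduct M M _) ⟩
  ∑[ a₁ ∈ L ] ∑[ a₂ ∈ L ] ∑[ u₁ ∈ M ] ∑[ u₂ ∈ M ] 𝟙 (witness? (a₁ , u₁) (a₂ , u₂))
    ≡⟨ ∑-cong L (λ a₁ → ∑-comm L M _) ⟩
  ∑[ a₁ ∈ L ] ∑[ u₁ ∈ M ] ∑[ a₂ ∈ L ] ∑[ u₂ ∈ M ] 𝟙 (witness? (a₁ , u₁) (a₂ , u₂))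
    ≡⟨ sym (trans (∑-cartesianProduct L M _)
                  (∑-cong L λ a₁ → ∑-cong M λ u₁ → ∑-cartesianProduct L M _)) ⟩
  edgeCount (cartesianProduct L M) ∎
  where
  open ≡-Reasoning
  L = elems A
  M = elems U

x²<12ne : ∀ m x e E → 6 * suc m ≤ x → x * x ≤ suc (m + m) * E → E ≤ (e + e) + (x + x) →
          x * x < 12 * suc m * e
x²<12ne m x@(suc _) e E 6n≤x x²≤NE E≤ =
  *-cancelˡ-< N (x * x) (12 * n * e)
    (+-cancelʳ-< (12 * n * N * x) (N * (x * x)) (N * (12 * n * e)) (begin-strict
      N * (x * x) + 12 * n * N * x
        <⟨ +-monoʳ-< (N * (x * x)) (*-monoˡ-< x 12nN<Kx) ⟩
      N * (x * x) + K * x * x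
        ≡⟨ split-6n m x ⟩
      6 * n * (x * x)
        ≤⟨ *-monoʳ-≤ (6 * n) (≤-trans x²≤NE (*-monoʳ-≤ N E≤)) ⟩
      6 * n * (N * ((e + e) + (x + x)))
        ≡⟨ expand m e x ⟩
      N * (12 * n * e) + 12 * n * N * x ∎))
  where
  open ≤-Reasoning
  n = suc m
  N = suc (m + m)
  -- K = 6n − N; the margin 12nN < 6nK is where x ≥ 6n enters.
  K = 4 * m + 5
  factor : ∀ m → 12 * suc m * suc (m + m) + 18 * suc m ≡ (4 * m + 5) * (6 * suc m)
  factor = solve-∀
  12nN<Kx : 12 * n * N < K * x
  12nN<Kx = begin-strict
    12 * n * N            <⟨ m<m+n (12 * n * N) (s≤s z≤n) ⟩
    12 * n * N + 18 * n   ≡⟨ factor m ⟩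
    K * (6 * n)           ≤⟨ *-monoʳ-≤ K 6n≤x ⟩
    K * x                 ∎
  split-6n : ∀ m x → suc (m + m) * (x * x) + (4 * m + 5) * x * x ≡ 6 * suc m * (x * x)
  split-6n = solve-∀
  expand : ∀ m e x → 6 * suc m * (suc (m + m) * ((e + e) + (x + x))) ≡
                     suc (m + m) * (12 * suc m * e) + 12 * suc m * suc (m + m) * x
  expand = solve-∀

lemma2p1 : (n : ℕ) → 1 ≤ n → (A U : Subset n) →
           6 * n ≤ ∣ A ∣ * ∣ U ∣ →
           (∣ A ∣ ^ 2) * (∣ U ∣ ^ 2) < 12 * n * eH U A
lemma2p1 (suc m) _ A U 6n≤|A||U| =
  subst₂ _<_ (trans (cong (λ k → k * k) x≡|A||U|) (sym (squares ∣ A ∣ ∣ U ∣)))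
             (cong (12 * suc m *_) (sym (eH≡edgeCount U A)))
    (x²<12ne m x (edgeCount P) (energy pairSum P)
      (subst (6 * suc m ≤_) (sym x≡|A||U|) 6n≤|A||U|)
      (length²≤N*energy pairSum pairSum<2n-1 P)
      (energy≤2edges+2length P (cartesianProduct⁺ (elems-unique A) (elems-unique U))))
  where
  P = cartesianProduct (elems A) (elems U)
  x = length P
  x≡|A||U| : x ≡ ∣ A ∣ * ∣ U ∣
  x≡|A||U| = trans (length-cartesianProduct (elems A) (elems U))
                   (cong₂ _*_ (length-elems A) (length-elems U))
  pairSum<2n-1 : (p : Fin (suc m) × Fin (suc m)) → pairSum p < suc (m + m)
  pairSum<2n-1 (a , u) = s≤s (+-mono-≤ (toℕ≤pred[n] a) (toℕ≤pred[n] u))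
  squares : ∀ a u → (a * (a * 1)) * (u * (u * 1)) ≡ (a * u) * (a * u)
  squares = solve-∀
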